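{- Let $r\ge 2$ and let $\mathcal{H}$ be an $r$-uniform hypergraph that contains no Berge path of length $r+1$ and no Berge cycle of length $r+1$. If $\mathcal{H}$ contains a Berge cycle of length $r$, then there is a set $S$ of $r+1$ vertices of $\mathcal{H}$ such that at most $r$ hyperedges of $\mathcal{H}$ contain a vertex of $S$.
   Context: An $r$-uniform hypergraph has hyperedges that are distinct $r$-element subsets of its vertex set. A Berge path of length $k$ is a collection of $k$ distinct hyperedges $h_1,\dots,h_k$ and $k+1$ distinct vertices $v_1,\dots,v_{k+1}$ with $v_i,v_{i+1}\in h_i$ for all $1\le i\le k$. A Berge cycle of length $k$ is an alternating sequence $v_1,h_1,v_2,h_2,\dots,v_k,h_k,v_1$ of distinct vertices $v_i$ and distinct hyperedges $h_i$ with $v_i,v_{i+1}\in h_i$ for $1\le i\le k-1$ and $v_k,v_1\in h_k$. -}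

module Defs where

open import Data.Nat using (ℕ; zero; suc; _≤_)
open import Data.Fin using (Fin; zero; suc; inject₁; fromℕ)
open import Data.Fin.Subset using (Subset; _∈_; _∩_; ∣_∣; Nonempty)
open import Data.Fin.Subset.Properties using (nonempty?)
open import Data.Vec using (tabulate)
open import Data.Product using (Σ; _×_; _,_)
open import Function.Definitions using (Injective)
open import Relation.Binary.PropositionalEquality using (_≡_)
open import Relation.Nullary using (does)
open import Data.Empty using (⊥)

record Hypergraph (r n : ℕ) : Set where
  field
    m        : ℕ
    edge     : Fin m → Subset n
    distinct : Injective _≡_ _≡_ edge
    uniform  : ∀ i → ∣ edge i ∣ ≡ r

open Hypergraph public

BergePath : ∀ {r n} → Hypergraph r n → ℕ → Set
BergePath {n = n} H k =
  Σ (Fin (suc k) → Fin n) λ v →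
  Σ (Fin k → Fin (m H)) λ h →
    Injective _≡_ _≡_ v × Injective _≡_ _≡_ h ×
    (∀ (i : Fin k) → (v (inject₁ i) ∈ edge H (h i)) × (v (suc i) ∈ edge H (h i)))


BergeCycle : ∀ {r n} → Hypergraph r n → ℕ → Set
BergeCycle H zero = ⊥
BergeCycle {n = n} H (suc k) =
  Σ (Fin (suc k) → Fin n) λ v →
  Σ (Fin (suc k) → Fin (m H)) λ h →
    Injective _≡_ _≡_ v × Injective _≡_ _≡_ h ×
    (∀ (i : Fin k) → (v (inject₁ i) ∈ edge H (h (inject₁ i)))
                   × (v (suc i) ∈ edge H (h (inject₁ i)))) ×
    (v (fromℕ k) ∈ edge H (h (fromℕ k))) × (v zero ∈ edge H (h (fromℕ k)))

edgesMeeting : ∀ {r n} (H : Hypergraph r n) → Subset n → Subset (m H)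
edgesMeeting H S = tabulate λ i → does (nonempty? (edge H i ∩ S))

{-# OPTIONS --safe #-}
module Submission where

-- Let C = v₀ h₀ v₁ … h_K v₀ be the Berge cycle, of length r = K + 1.  The key observation: if a
-- Berge path v₀ h₀ … v_r of length r is followed by a further edge h through v_r, then
-- h ⊆ {v₁, …, v_r}, because another vertex of h would extend the path to length r + 1 and v₀ ∈ h
-- would close a cycle of length r + 1.  Since both sets have r elements, at most one edge lies
-- inside V(C); so some edge of C contains a vertex u ∉ V(C).  Applying the observation to paths
-- that run along C (rotated or reversed) after a detour through an edge e ∉ C shows that no such
-- e meets V(C) ∪ {u}.  Hence S = V(C) ∪ {u} is met only by the r edges of C.

open import Defs
open import Data.Fin using (Fin; zero; suc; inject₁; fromℕ; opposite)
open import Data.Fin.Induction using (>-weakInduction)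
open import Data.Fin.Properties
  using (any?; 0≢1+n; suc-injective; inject₁-injective; fromℕ≢inject₁; opposite-involutive)
open import Data.Fin.Subset
  using (Subset; inside; outside; _∈_; _∉_; _⊆_; _∪_; _∩_; ⁅_⁆; ∣_∣; ⊥; Nonempty)
open import Data.Fin.Subset.Properties
  using ( _∈?_; _⊆?_; nonempty?; ∉⊥; ∣⊥∣≡0; ∣⁅x⁆∣≡1; x∈⁅x⁆; x∈⁅y⁆⇒x≡y; x≢y⇒x∉⁅y⁆; x∈p∪q⁺; x∈p∪q⁻
        ; x∈p∩q⁻; Empty-unique; ⊆-antisym; p⊆q⇒∣p∣≤∣q∣; p⊂q⇒∣p∣<∣q∣)
open import Data.Nat using (ℕ; zero; suc; _+_; _≤_; s≤s)
open import Data.Nat.Properties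
  using (+-suc; +-identityʳ; m≤m+n; <⇒≱; ≤-trans; ≤-reflexive; module ≤-Reasoning)
open import Data.Product using (Σ; ∃-syntax; ∃₂; _×_; _,_; proj₁; proj₂)
open import Data.Sum using ([_,_]; inj₁; inj₂)
import Data.Vec as Vec
open import Data.Vec.Properties using (lookup∘tabulate; []=⇒lookup)
open import Data.Vec.Functional using (_∷_; head; tail; init; last; reverse)
open import Function using (_∘_; id)
open import Function.Definitions using (Injective)
open import Relation.Nullary using (¬_; yes; no; contradiction)
open import Relation.Nullary.Decidable using (decidable-stable; _×-dec_; ¬?)
open import Relation.Binary.PropositionalEquality
  using (_≡_; _≢_; refl; sym; trans; cong; subst; subst₂; module ≡-Reasoning)

private
  variable
    k l n R : ℕ

∣p∪q∣+∣p∩q∣≡∣p∣+∣q∣ : (p q : Subset n) → ∣ p ∪ q ∣ + ∣ p ∩ q ∣ ≡ ∣ p ∣ + ∣ q ∣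
∣p∪q∣+∣p∩q∣≡∣p∣+∣q∣ Vec.[] Vec.[] = refl
∣p∪q∣+∣p∩q∣≡∣p∣+∣q∣ (outside Vec.∷ p) (outside Vec.∷ q) = ∣p∪q∣+∣p∩q∣≡∣p∣+∣q∣ p q
∣p∪q∣+∣p∩q∣≡∣p∣+∣q∣ (outside Vec.∷ p) (inside Vec.∷ q) =
  trans (cong suc (∣p∪q∣+∣p∩q∣≡∣p∣+∣q∣ p q)) (sym (+-suc ∣ p ∣ ∣ q ∣))
∣p∪q∣+∣p∩q∣≡∣p∣+∣q∣ (inside Vec.∷ p) (outside Vec.∷ q) = cong suc (∣p∪q∣+∣p∩q∣≡∣p∣+∣q∣ p q)
∣p∪q∣+∣p∩q∣≡∣p∣+∣q∣ (inside Vec.∷ p) (inside Vec.∷ q) = cong suc (begin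
  ∣ p ∪ q ∣ + suc ∣ p ∩ q ∣   ≡⟨ +-suc ∣ p ∪ q ∣ ∣ p ∩ q ∣ ⟩
  suc (∣ p ∪ q ∣ + ∣ p ∩ q ∣) ≡⟨ cong suc (∣p∪q∣+∣p∩q∣≡∣p∣+∣q∣ p q) ⟩
  suc (∣ p ∣ + ∣ q ∣)         ≡⟨ +-suc ∣ p ∣ ∣ q ∣ ⟨
  ∣ p ∣ + suc ∣ q ∣           ∎)
  where open ≡-Reasoning

∣⁅x⁆∪p∣≤1+∣p∣ : ∀ (x : Fin n) p → ∣ ⁅ x ⁆ ∪ p ∣ ≤ suc ∣ p ∣
∣⁅x⁆∪p∣≤1+∣p∣ x p = begin
  ∣ ⁅ x ⁆ ∪ p ∣                 ≤⟨ m≤m+n _ _ ⟩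
  ∣ ⁅ x ⁆ ∪ p ∣ + ∣ ⁅ x ⁆ ∩ p ∣ ≡⟨ ∣p∪q∣+∣p∩q∣≡∣p∣+∣q∣ ⁅ x ⁆ p ⟩
  ∣ ⁅ x ⁆ ∣ + ∣ p ∣             ≡⟨ cong (_+ ∣ p ∣) (∣⁅x⁆∣≡1 x) ⟩
  suc ∣ p ∣                     ∎
  where open ≤-Reasoning

x∉p⇒∣⁅x⁆∪p∣≡1+∣p∣ : ∀ {x : Fin n} {p} → x ∉ p → ∣ ⁅ x ⁆ ∪ p ∣ ≡ suc ∣ p ∣
x∉p⇒∣⁅x⁆∪p∣≡1+∣p∣ {n = n} {x = x} {p} x∉p = begin
  ∣ ⁅ x ⁆ ∪ p ∣                 ≡⟨ +-identityʳ _ ⟨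
  ∣ ⁅ x ⁆ ∪ p ∣ + 0             ≡⟨ cong (∣ ⁅ x ⁆ ∪ p ∣ +_) ∣⁅x⁆∩p∣≡0 ⟨
  ∣ ⁅ x ⁆ ∪ p ∣ + ∣ ⁅ x ⁆ ∩ p ∣ ≡⟨ ∣p∪q∣+∣p∩q∣≡∣p∣+∣q∣ ⁅ x ⁆ p ⟩
  ∣ ⁅ x ⁆ ∣ + ∣ p ∣             ≡⟨ cong (_+ ∣ p ∣) (∣⁅x⁆∣≡1 x) ⟩
  suc ∣ p ∣                     ∎
  where
  open ≡-Reasoning
  ⁅x⁆∩p-empty : ¬ Nonempty (⁅ x ⁆ ∩ p)
  ⁅x⁆∩p-empty (y , y∈⁅x⁆∩p) with x∈p∩q⁻ ⁅ x ⁆ p y∈⁅x⁆∩p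
  ... | y∈⁅x⁆ , y∈p = x∉p (subst (_∈ p) (x∈⁅y⁆⇒x≡y x y∈⁅x⁆) y∈p)
  ∣⁅x⁆∩p∣≡0 : ∣ ⁅ x ⁆ ∩ p ∣ ≡ 0
  ∣⁅x⁆∩p∣≡0 = trans (cong ∣_∣ (Empty-unique ⁅x⁆∩p-empty)) (∣⊥∣≡0 n)

x∉p∪q⁺ : ∀ {x : Fin n} {p q} → x ∉ p → x ∉ q → x ∉ p ∪ q
x∉p∪q⁺ {p = p} {q} x∉p x∉q x∈p∪q = [ x∉p , x∉q ] (x∈p∪q⁻ p q x∈p∪q)

p⊆q∧∣q∣≤∣p∣⇒p≡q : ∀ {p q : Subset n} → p ⊆ q → ∣ q ∣ ≤ ∣ p ∣ → p ≡ q
p⊆q∧∣q∣≤∣p∣⇒p≡q {p = p} p⊆q ∣q∣≤∣p∣ = ⊆-antisym p⊆q λ {x} x∈q →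
  decidable-stable (x ∈? p) λ x∉p → <⇒≱ (p⊂q⇒∣p∣<∣q∣ (p⊆q , x , x∈q , x∉p)) ∣q∣≤∣p∣

p⊈q⇒∃∉ : ∀ {p q : Subset n} → ¬ p ⊆ q → ∃[ x ] x ∈ p × x ∉ q
p⊈q⇒∃∉ {p = p} {q} p⊈q = decidable-stable (any? λ x → x ∈? p ×-dec ¬? (x ∈? q)) λ ∄ →
  p⊈q λ {x} x∈p → decidable-stable (x ∈? q) λ x∉q → ∄ (x , x∈p , x∉q)

image : (Fin k → Fin n) → Subset n
image {zero}  f = ⊥
image {suc k} f = ⁅ head f ⁆ ∪ image (tail f)

∈-image : ∀ (f : Fin k → Fin n) i → f i ∈ image f
∈-image f zero    = x∈p∪q⁺ (inj₁ (x∈⁅x⁆ (f zero)))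
∈-image f (suc i) = x∈p∪q⁺ (inj₂ (∈-image (tail f) i))

∈-image⁻ : ∀ (f : Fin k → Fin n) {x} → x ∈ image f → ∃[ i ] f i ≡ x
∈-image⁻ {zero}  f x∈ = contradiction x∈ ∉⊥
∈-image⁻ {suc k} f x∈ with x∈p∪q⁻ ⁅ head f ⁆ (image (tail f)) x∈
... | inj₁ x∈⁅f₀⁆ = zero , sym (x∈⁅y⁆⇒x≡y (head f) x∈⁅f₀⁆)
... | inj₂ x∈tail with ∈-image⁻ (tail f) x∈tail
...   | i , fi≡x = suc i , fi≡x

image-⊆ : ∀ {f : Fin k → Fin n} {g : Fin l → Fin n} → (∀ i → ∃[ j ] f i ≡ g j) → image f ⊆ image g
image-⊆ {f = f} {g} f⊆g x∈ with ∈-image⁻ f x∈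
... | i , refl with f⊆g i
...   | j , fi≡gj = subst (_∈ image g) (sym fi≡gj) (∈-image g j)

image-reverse⊆ : ∀ (f : Fin k → Fin n) → image (reverse f) ⊆ image f
image-reverse⊆ f = image-⊆ {f = reverse f} {g = f} λ i → opposite i , refl

image-last∷init⊆ : ∀ (f : Fin (suc k) → Fin n) → image (last f ∷ init f) ⊆ image f
image-last∷init⊆ f = image-⊆ {f = last f ∷ init f} {g = f}
  λ { zero → fromℕ _ , refl ; (suc i) → inject₁ i , refl }

image-tail⊆ : ∀ (f : Fin (suc k) → Fin n) → image (tail f) ⊆ image f
image-tail⊆ f = x∈p∪q⁺ ∘ inj₂

∣image∣≤ : ∀ (f : Fin k → Fin n) → ∣ image f ∣ ≤ k
∣image∣≤ {zero}  {n} f = ≤-reflexive (∣⊥∣≡0 n)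
∣image∣≤ {suc k} f = ≤-trans (∣⁅x⁆∪p∣≤1+∣p∣ (head f) _) (s≤s (∣image∣≤ (tail f)))

head∉image-tail : ∀ {f : Fin (suc k) → Fin n} → Injective _≡_ _≡_ f → head f ∉ image (tail f)
head∉image-tail {f = f} f-injective f₀∈ with ∈-image⁻ (tail f) f₀∈
... | i , fᵢ₊₁≡f₀ = 0≢1+n (f-injective (sym fᵢ₊₁≡f₀))

last∉image-init : ∀ {f : Fin (suc k) → Fin n} → Injective _≡_ _≡_ f → last f ∉ image (init f)
last∉image-init {f = f} f-injective fₖ∈ with ∈-image⁻ (init f) fₖ∈
... | i , fᵢ≡fₖ = fromℕ≢inject₁ (sym (f-injective fᵢ≡fₖ))

∣image∣≡ : ∀ {f : Fin k → Fin n} → Injective _≡_ _≡_ f → ∣ image f ∣ ≡ k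
∣image∣≡ {zero} {n} _ = ∣⊥∣≡0 n
∣image∣≡ {suc k} f-injective =
  trans (x∉p⇒∣⁅x⁆∪p∣≡1+∣p∣ (head∉image-tail f-injective))
        (cong suc (∣image∣≡ λ eq → suc-injective (f-injective eq)))

∷-injective : ∀ {x : Fin n} {f : Fin k → Fin n} →
              x ∉ image f → Injective _≡_ _≡_ f → Injective _≡_ _≡_ (x ∷ f)
∷-injective         x∉ f-injective {zero}  {zero}  _     = refl
∷-injective {f = f} x∉ f-injective {zero}  {suc j} x≡fⱼ  =
  contradiction (subst (_∈ image f) (sym x≡fⱼ) (∈-image f j)) x∉
∷-injective {f = f} x∉ f-injective {suc i} {zero}  fᵢ≡x  =
  contradiction (subst (_∈ image f) fᵢ≡x (∈-image f i)) x∉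
∷-injective         x∉ f-injective {suc i} {suc j} fᵢ≡fⱼ = cong suc (f-injective fᵢ≡fⱼ)

opposite-inject₁ : ∀ (i : Fin n) → opposite (inject₁ i) ≡ suc (opposite i)
opposite-inject₁ {suc n} zero    = refl
opposite-inject₁ {suc n} (suc i) = cong inject₁ (opposite-inject₁ i)

opposite-fromℕ : ∀ n → opposite (fromℕ n) ≡ zero
opposite-fromℕ zero    = refl
opposite-fromℕ (suc n) = cong inject₁ (opposite-fromℕ n)

opposite-injective : Injective _≡_ _≡_ (opposite {n})
opposite-injective {x = i} {j} eq =
  trans (sym (opposite-involutive i)) (trans (cong opposite eq) (opposite-involutive j))

∈edgesMeeting⁻ : ∀ {r} {H : Hypergraph r n} {S e} → e ∈ edgesMeeting H S → Nonempty (edge H e ∩ S)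
∈edgesMeeting⁻ {H = H} {S} {e} e∈
  with nonempty? (edge H e ∩ S) | trans (sym (lookup∘tabulate _ e)) ([]=⇒lookup e∈)
... | yes meets | _  = meets
... | no _      | ()

module _ {r n} (H : Hypergraph r n) where

  IsWalk : (Fin (suc k) → Fin n) → (Fin k → Fin (m H)) → Set
  IsWalk v h = ∀ i → v (inject₁ i) ∈ edge H (h i) × v (suc i) ∈ edge H (h i)

  -- A Berge path v₀ h₀ v₁ … v_R followed by one more edge h_R through v_R:
  -- a Berge cycle of length R + 1 without the incidence v₀ ∈ h_R.
  record Path⁺ (R : ℕ) : Set where
    field
      v           : Fin (suc R) → Fin n
      h           : Fin (suc R) → Fin (m H)
      v-injective : Injective _≡_ _≡_ v
      h-injective : Injective _≡_ _≡_ h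
      walk        : IsWalk v (init h)
      last∈last   : last v ∈ edge H (last h)

    vertices : Subset n
    vertices = image v

    edges : Subset (m H)
    edges = image h

  record Cycle (K : ℕ) : Set where
    field
      path : Path⁺ K
    open Path⁺ path public
    field
      head∈last : head v ∈ edge H (last h)

  record Rotation {K} (c : Cycle K) (j : Fin (suc K)) : Set where
    field
      cycle     : Cycle K
      vertices⊆ : Cycle.vertices cycle ⊆ Cycle.vertices c
      edges⊆    : Cycle.edges cycle ⊆ Cycle.edges c
      head-v    : head (Cycle.v cycle) ≡ Cycle.v c j
      head-h    : head (Cycle.h cycle) ≡ Cycle.h c j

module _ {r n} {H : Hypergraph r n} where

  IsWalk-reverse : ∀ {v : Fin (suc k) → Fin n} {h} → IsWalk H v h → IsWalk H (reverse v) (reverse h)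
  IsWalk-reverse {v = v} {h} walk i =
    subst (λ j → v j ∈ edge H (h (opposite i))) (sym (opposite-inject₁ i)) (proj₂ (walk (opposite i))) ,
    proj₁ (walk (opposite i))

  prepend : ∀ x g (p : Path⁺ H R) → let open Path⁺ p in
            x ∉ vertices → g ∉ edges → x ∈ edge H g → head v ∈ edge H g → Path⁺ H (suc R)
  prepend x g p x∉ g∉ x∈g v₀∈g = record
    { v           = x ∷ v
    ; h           = g ∷ h
    ; v-injective = ∷-injective x∉ v-injective
    ; h-injective = ∷-injective g∉ h-injective
    ; walk        = λ { zero → x∈g , v₀∈g ; (suc i) → walk i }
    ; last∈last   = last∈last
    }
    where open Path⁺ p

  behead : Path⁺ H (suc R) → Path⁺ H R
  behead p = record
    { v           = tail v
    ; h           = tail h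
    ; v-injective = λ eq → suc-injective (v-injective eq)
    ; h-injective = λ eq → suc-injective (h-injective eq)
    ; walk        = walk ∘ suc
    ; last∈last   = last∈last
    }
    where open Path⁺ p

  last-edge⊆tail-vertices : ¬ BergePath H (suc R) → ¬ BergeCycle H (suc R) →
                            (p : Path⁺ H R) → let open Path⁺ p in edge H (last h) ⊆ image (tail v)
  last-edge⊆tail-vertices {R} no-path no-cycle p {x} x∈last =
    [ (λ x∈⁅v₀⁆ → contradiction (closing (x∈⁅y⁆⇒x≡y (head v) x∈⁅v₀⁆)) no-cycle) , id ]
      (x∈p∪q⁻ ⁅ head v ⁆ (image (tail v)) x∈vertices)
    where
    open Path⁺ p
    extension : x ∉ vertices → BergePath H (suc R)
    extension x∉ =
      x ∷ reverse v , reverse h ,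
      ∷-injective (x∉ ∘ image-reverse⊆ v) (λ eq → opposite-injective (v-injective eq)) ,
      (λ eq → opposite-injective (h-injective eq)) ,
      λ { zero → x∈last , last∈last ; (suc i) → IsWalk-reverse {v = v} {h = init h} walk i }
    closing : x ≡ head v → BergeCycle H (suc R)
    closing x≡v₀ =
      v , h , (λ {_} {_} → v-injective) , (λ {_} {_} → h-injective) , walk , last∈last ,
      subst (_∈ edge H (last h)) x≡v₀ x∈last
    x∈vertices : x ∈ vertices
    x∈vertices = decidable-stable (x ∈? vertices) (no-path ∘ extension)

  rotate : Cycle H (suc k) → Cycle H (suc k)
  rotate c = record
    { path = record
      { v           = last v ∷ init v
      ; h           = last h ∷ init h
      ; v-injective = ∷-injective (last∉image-init v-injective) λ eq → inject₁-injective (v-injective eq)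
      ; h-injective = ∷-injective (last∉image-init h-injective) λ eq → inject₁-injective (h-injective eq)
      ; walk        = λ { zero → last∈last , head∈last ; (suc i) → walk (inject₁ i) }
      ; last∈last   = proj₁ (walk (fromℕ _))
      }
    ; head∈last = proj₂ (walk (fromℕ _))
    }
    where open Cycle c

  -- Position inject₁ i of c is position suc i of rotate c.
  rotation : ∀ (j : Fin (suc (suc k))) (c : Cycle H (suc k)) → Rotation H c j
  rotation = >-weakInduction (λ j → ∀ c → Rotation H c j) rotate-once rotate-more
    where
    rotate-once : ∀ c → Rotation H c (fromℕ _)
    rotate-once c = record
      { cycle     = rotate c
      ; vertices⊆ = image-last∷init⊆ (Cycle.v c)
      ; edges⊆    = image-last∷init⊆ (Cycle.h c)
      ; head-v    = refl
      ; head-h    = refl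
      }
    rotate-more : ∀ i → (∀ c → Rotation H c (suc i)) → ∀ c → Rotation H c (inject₁ i)
    rotate-more i rotation-from c = record
      { cycle     = cycle
      ; vertices⊆ = Rotation.vertices⊆ (rotate-once c) ∘ vertices⊆
      ; edges⊆    = Rotation.edges⊆ (rotate-once c) ∘ edges⊆
      ; head-v    = head-v
      ; head-h    = head-h
      }
      where open Rotation (rotation-from (rotate c))

  reversed : Cycle H (suc k) → Path⁺ H (suc k)
  reversed {k} c = record
    { v           = head v ∷ reverse (tail v)
    ; h           = reverse h
    ; v-injective = ∷-injective (head∉image-tail v-injective ∘ image-reverse⊆ (tail v))
                                λ eq → opposite-injective (suc-injective (v-injective eq))
    ; h-injective = λ eq → opposite-injective (h-injective eq)
    ; walk        = walk′
    ; last∈last   = subst₂ (λ i j → v (suc i) ∈ edge H (h j))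
                           (sym (opposite-fromℕ k)) (sym (opposite-fromℕ (suc k))) (proj₂ (walk zero))
    }
    where
    open Cycle c
    walk′ : IsWalk H (head v ∷ reverse (tail v)) (init (reverse h))
    walk′ zero    = head∈last , last∈last
    walk′ (suc i) =
      subst (λ j → reverse (tail v) (inject₁ i) ∈ edge H (h j) × reverse (tail v) (suc i) ∈ edge H (h j))
            (cong inject₁ (sym (opposite-inject₁ i)))
            (IsWalk-reverse {v = tail v} {h = λ i → h (suc (inject₁ i))} (walk ∘ suc) i)

  reversed-vertices⊆ : ∀ (c : Cycle H (suc k)) → Path⁺.vertices (reversed c) ⊆ Cycle.vertices c
  reversed-vertices⊆ c = image-⊆ {f = Path⁺.v (reversed c)} {g = Cycle.v c}
    λ { zero → zero , refl ; (suc i) → suc (opposite i) , refl }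

  reversed-edges⊆ : ∀ (c : Cycle H (suc k)) → Path⁺.edges (reversed c) ⊆ Cycle.edges c
  reversed-edges⊆ c = image-reverse⊆ (Cycle.h c)

  last-h-reversed : ∀ (c : Cycle H (suc k)) → last (Path⁺.h (reversed c)) ≡ head (Cycle.h c)
  last-h-reversed {k} c = cong (Cycle.h c) (opposite-fromℕ (suc k))

module _ {k n} {H : Hypergraph (suc k) n} where
  open Cycle

  edge⊆vertices⇒≡ : ∀ (c : Cycle H k) {e} → edge H e ⊆ vertices c → edge H e ≡ vertices c
  edge⊆vertices⇒≡ c {e} e⊆ =
    p⊆q∧∣q∣≤∣p∣⇒p≡q e⊆ (≤-reflexive (trans (∣image∣≡ (v-injective c)) (sym (uniform H e))))

  edges⊆vertices-unique : ∀ (c : Cycle H k) {e e′} →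
                          edge H e ⊆ vertices c → edge H e′ ⊆ vertices c → e ≡ e′
  edges⊆vertices-unique c e⊆ e′⊆ =
    distinct H (trans (edge⊆vertices⇒≡ c e⊆) (sym (edge⊆vertices⇒≡ c e′⊆)))

module _ {k n} {H : Hypergraph (suc (suc k)) n} where
  open Cycle

  edge⊈⁅x⁆ : ∀ e x → ¬ edge H e ⊆ ⁅ x ⁆
  edge⊈⁅x⁆ e x e⊆⁅x⁆ with subst₂ _≤_ (uniform H e) (∣⁅x⁆∣≡1 x) (p⊆q⇒∣p∣≤∣q∣ e⊆⁅x⁆)
  ... | s≤s ()

  some-edge-escapes : ∀ (c : Cycle H (suc k)) → ∃₂ λ i u → u ∈ edge H (h c i) × u ∉ vertices c
  some-edge-escapes c with edge H (h c zero) ⊆? vertices c | edge H (h c (suc zero)) ⊆? vertices c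
  ... | no h₀⊈  | _       = zero , p⊈q⇒∃∉ h₀⊈
  ... | yes _   | no h₁⊈  = suc zero , p⊈q⇒∃∉ h₁⊈
  ... | yes h₀⊆ | yes h₁⊆ = contradiction (h-injective c (edges⊆vertices-unique c h₀⊆ h₁⊆)) λ ()

module _ {k n} {H : Hypergraph (suc (suc k)) n}
         (no-path : ¬ BergePath H (3 + k)) (no-cycle : ¬ BergeCycle H (3 + k)) where
  open Cycle

  -- The path w e v₀ h₀ … v_R, followed by h_R.
  escape⇒last-edge⊆vertices : ∀ (p : Path⁺ H (suc k)) {e w} →
    e ∉ Path⁺.edges p → head (Path⁺.v p) ∈ edge H e → w ∈ edge H e → w ∉ Path⁺.vertices p →
    edge H (last (Path⁺.h p)) ⊆ Path⁺.vertices p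
  escape⇒last-edge⊆vertices p e∉ v₀∈e w∈e w∉ =
    last-edge⊆tail-vertices no-path no-cycle (prepend _ _ p w∉ e∉ w∈e v₀∈e)

  -- The path u h₀ v₀ e v₁ h₁ … v_K, followed by h_K.
  parallel⇒last-edge⊆vertices : ∀ (c : Cycle H (suc k)) {e u} →
    e ∉ edges c → v c zero ∈ edge H e → v c (suc zero) ∈ edge H e →
    u ∈ edge H (head (h c)) → u ∉ vertices c → edge H (last (h c)) ⊆ vertices c
  parallel⇒last-edge⊆vertices c {e} {u} e∉ v₀∈e v₁∈e u∈h₀ u∉ =
    last-edge⊆tail-vertices no-path no-cycle
      (prepend u (head (h c)) via-e u∉ h₀∉ u∈h₀ (proj₁ (walk c zero)))
    where
    via-e : Path⁺ H (suc k)
    via-e = prepend (head (v c)) e (behead (path c))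
              (head∉image-tail (v-injective c)) (e∉ ∘ image-tail⊆ (h c)) v₀∈e v₁∈e
    h₀≢e : head (h c) ≢ e
    h₀≢e h₀≡e = e∉ (subst (_∈ edges c) h₀≡e (∈-image (h c) zero))
    h₀∉ : head (h c) ∉ Path⁺.edges via-e
    h₀∉ = x∉p∪q⁺ (x≢y⇒x∉⁅y⁆ h₀≢e) (head∉image-tail (h-injective c))

  -- The path w e u h₀ v₁ h₁ … v_K, followed by h_K ∋ v₀.
  outer-edge-through-escape⊆ : ∀ (c : Cycle H (suc k)) {e u} →
    u ∈ edge H (head (h c)) → u ∉ vertices c → e ∉ edges c → u ∈ edge H e →
    edge H e ⊆ ⁅ u ⁆ ∪ vertices c
  outer-edge-through-escape⊆ c {e} {u} u∈h₀ u∉ e∉ u∈e {w} w∈e =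
    decidable-stable (w ∈? ⁅ u ⁆ ∪ vertices c) λ w∉ →
      v₀∉ (last-edge⊆tail-vertices no-path no-cycle
             (prepend w e via-u (w∉via-u w∉) e∉ w∈e u∈e) (head∈last c))
    where
    via-u : Path⁺ H (suc k)
    via-u = prepend u (head (h c)) (behead (path c))
              (u∉ ∘ image-tail⊆ (v c)) (head∉image-tail (h-injective c)) u∈h₀ (proj₂ (walk c zero))
    w∉via-u : w ∉ ⁅ u ⁆ ∪ vertices c → w ∉ Path⁺.vertices via-u
    w∉via-u w∉ = x∉p∪q⁺ (w∉ ∘ x∈p∪q⁺ ∘ inj₁) (w∉ ∘ x∈p∪q⁺ ∘ inj₂ ∘ image-tail⊆ (v c))
    v₀≢u : head (v c) ≢ u
    v₀≢u v₀≡u = u∉ (subst (_∈ vertices c) v₀≡u (∈-image (v c) zero))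
    v₀∉ : head (v c) ∉ Path⁺.vertices via-u
    v₀∉ = x∉p∪q⁺ (x≢y⇒x∉⁅y⁆ v₀≢u) (head∉image-tail (v-injective c))

  outer-edge-through-head⊆vertices : ∀ (c : Cycle H (suc k)) {e} →
    e ∉ edges c → head (v c) ∈ edge H e → edge H e ⊆ vertices c
  outer-edge-through-head⊆vertices c {e} e∉ v₀∈e {w} w∈e = decidable-stable (w ∈? vertices c) λ w∉ →
    0≢1+n (h-injective c (edges⊆vertices-unique c (backward w∉) (forward w∉)))
    where
    forward : w ∉ vertices c → edge H (last (h c)) ⊆ vertices c
    forward = escape⇒last-edge⊆vertices (path c) e∉ v₀∈e w∈e
    backward : w ∉ vertices c → edge H (head (h c)) ⊆ vertices c
    backward w∉ {x} x∈h₀ = reversed-vertices⊆ c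
      (escape⇒last-edge⊆vertices (reversed c) (e∉ ∘ reversed-edges⊆ c) v₀∈e w∈e (w∉ ∘ reversed-vertices⊆ c)
        (subst (λ g → x ∈ edge H g) (sym (last-h-reversed c)) x∈h₀))

  outer-edge⊈vertices : ∀ (c : Cycle H (suc k)) {e} → e ∉ edges c → ¬ edge H e ⊆ vertices c
  outer-edge⊈vertices c {e} e∉ e⊆V with some-edge-escapes c
  ... | i , u , u∈hᵢ , u∉ = e∉ (edges⊆ (subst (_∈ edges cycle) last≡e (∈-image (h cycle) (fromℕ _))))
    where
    open Rotation (rotation i c)
    ∈e : ∀ j → v cycle j ∈ edge H e
    ∈e j = subst (v cycle j ∈_) (sym (edge⊆vertices⇒≡ c e⊆V)) (vertices⊆ (∈-image (v cycle) j))
    last⊆ : edge H (last (h cycle)) ⊆ vertices cycle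
    last⊆ = parallel⇒last-edge⊆vertices cycle (e∉ ∘ edges⊆) (∈e zero) (∈e (suc zero))
              (subst (λ g → u ∈ edge H g) (sym head-h) u∈hᵢ) (u∉ ∘ vertices⊆)
    last≡e : last (h cycle) ≡ e
    last≡e = edges⊆vertices-unique c (vertices⊆ ∘ last⊆) e⊆V

  outer-edge-avoids-vertices : ∀ (c : Cycle H (suc k)) {e x} →
    e ∉ edges c → x ∈ edge H e → x ∉ vertices c
  outer-edge-avoids-vertices c {e} e∉ x∈e x∈V with ∈-image⁻ (v c) x∈V
  ... | j , vⱼ≡x = outer-edge⊈vertices cycle (e∉ ∘ edges⊆)
                     (outer-edge-through-head⊆vertices cycle (e∉ ∘ edges⊆)
                       (subst (_∈ edge H e) (sym (trans head-v vⱼ≡x)) x∈e))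
    where open Rotation (rotation j c)

  outer-edge-avoids-escapes : ∀ (c : Cycle H (suc k)) {i e u} →
    u ∈ edge H (h c i) → u ∉ vertices c → e ∉ edges c → u ∉ edge H e
  outer-edge-avoids-escapes c {i} {e} {u} u∈hᵢ u∉ e∉ u∈e with p⊈q⇒∃∉ (edge⊈⁅x⁆ {H = H} e u)
  ... | w , w∈e , w∉⁅u⁆ =
    [ w∉⁅u⁆ , outer-edge-avoids-vertices c e∉ w∈e ∘ vertices⊆ ]
      (x∈p∪q⁻ ⁅ u ⁆ (vertices cycle)
        (outer-edge-through-escape⊆ cycle (subst (λ g → u ∈ edge H g) (sym head-h) u∈hᵢ)
          (u∉ ∘ vertices⊆) (e∉ ∘ edges⊆) u∈e w∈e))
    where open Rotation (rotation i c)

  edgesMeeting⊆edges : ∀ (c : Cycle H (suc k)) {i u} →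
    u ∈ edge H (h c i) → u ∉ vertices c → edgesMeeting H (⁅ u ⁆ ∪ vertices c) ⊆ edges c
  edgesMeeting⊆edges c {u = u} u∈hᵢ u∉ {e} e∈ with ∈edgesMeeting⁻ {H = H} e∈
  ... | z , z∈e∩S with x∈p∩q⁻ (edge H e) (⁅ u ⁆ ∪ vertices c) z∈e∩S
  ...   | z∈e , z∈S = decidable-stable (e ∈? edges c) λ e∉ →
    [ (λ z∈⁅u⁆ → outer-edge-avoids-escapes c u∈hᵢ u∉ e∉ (subst (_∈ edge H e) (x∈⁅y⁆⇒x≡y u z∈⁅u⁆) z∈e))
    , outer-edge-avoids-vertices c e∉ z∈e
    ] (x∈p∪q⁻ ⁅ u ⁆ (vertices c) z∈S)

  small-neighbourhood : Cycle H (suc k) →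
    Σ (Subset n) λ S → ∣ S ∣ ≡ 3 + k × ∣ edgesMeeting H S ∣ ≤ 2 + k
  small-neighbourhood c with some-edge-escapes c
  ... | i , u , u∈hᵢ , u∉ =
    ⁅ u ⁆ ∪ vertices c ,
    trans (x∉p⇒∣⁅x⁆∪p∣≡1+∣p∣ u∉) (cong suc (∣image∣≡ (v-injective c))) ,
    ≤-trans (p⊆q⇒∣p∣≤∣q∣ (edgesMeeting⊆edges c u∈hᵢ u∉)) (∣image∣≤ (h c))

lemma2p2 : ∀ (r n : ℕ) → 2 ≤ r → (H : Hypergraph r n) →
    ¬ BergePath H (suc r) → ¬ BergeCycle H (suc r) → BergeCycle H r →
    Σ (Subset n) λ S → (∣ S ∣ ≡ suc r) × (∣ edgesMeeting H S ∣ ≤ r)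
lemma2p2 (suc zero) n (s≤s ()) H no-path no-cycle cycle
lemma2p2 (suc (suc k)) n _ H no-path no-cycle
         (v , h , v-injective , h-injective , walk , last∈last , head∈last) =
  small-neighbourhood {H = H} no-path no-cycle record
    { path      = record { v = v ; h = h ; v-injective = v-injective ; h-injective = h-injective
                         ; walk = walk ; last∈last = last∈last }
    ; head∈last = head∈last
    }
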